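{- Let $N$ be a network and $\phi\in\Phi(N)$. If $\phi$ is not derivable in the Logic of Secrets for $N$ (i.e. $\nvdash_N\phi$), then there is a finite protocol ${\cal P}$ over $N$ such that ${\cal P}\nvDash\phi$.
   Context: A network $N$ is a finite undirected graph (loops and multiple edges allowed) whose vertices are parties and whose edges, called channels, are labeled by secret variables (each channel may carry finitely many labels, each label used on only one channel); $Ch(N)$ is the set of channels. A semi-protocol over $N$ assigns to each channel $c$ a set $V(c)$ of values and to each party $p$ a predicate $L_p$ on the values of the channels incident with $p$; a run is a function $r$ with $r(c)\in V(c)$ for all $c$ satisfying all $L_p$; a protocol is a semi-protocol with at least one run; it is finite if every $V(c)$ is finite. $A$ functionally determines $B$ w.r.t. ${\cal P}$ if any two runs agreeing on all channels of $A$ agree on all channels of $B$. $\Phi(N)$ is the smallest set of formulas containing $A\rhd B$ for finite sets of channels $A,B$, the constant $\bot$, and closed under $\to$. Semantics: ${\cal P}\nvDash\bot$; ${\cal P}\vDash A\rhd B$ iff $A$ functionally determines $B$ w.r.t. ${\cal P}$; ${\cal P}\vDash\phi_1\to\phi_2$ iff ${\cal P}\nvDash\phi_1$ or ${\cal P}\vDash\phi_2$. A path is a sequence of channels forming an undirected walk; $G$ is a gateway between $A$ and $B$ if every path starting in $A$ and ending in $B$ contains a channel of $G$. The Logic of Secrets for $N$: all propositional tautologies, Modus Ponens, and axioms Reflexivity ($A\rhd B$ if $A\supseteq B$), Augmentation ($A\rhd B\to A\cup C\rhd B\cup C$), Transitivity ($A\rhd B\to(B\rhd C\to A\rhd C)$),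 Gateway ($A\rhd B\to G\rhd B$ if $G$ is a gateway between $A$ and $B$ in $N$). $\vdash_N\phi$ means $\phi$ is derivable. -}

module Defs where

open import Level using (Level; suc; zero)
open import Data.Nat using (ℕ)
open import Data.Bool using (Bool; true; false; not; _∨_)
open import Data.Fin using (Fin)
open import Data.Fin.Subset using (Subset; _∈_; _⊆_; _∪_)
open import Data.List using (List; []; _∷_; _++_; [_])
open import Data.List.Relation.Unary.Any using (Any)
open import Data.Product using (Σ; _×_; _,_; proj₁)
open import Data.Sum using (_⊎_)
open import Data.Empty using (⊥)
open import Relation.Binary.PropositionalEquality using (_≡_)
open import Function.Bundles using (_↔_)

-- Networks: finite undirected multigraphs (loops allowed).
-- Parties are Fin nParties, channels are Fin nChans; channel c joins
-- end₁ c and end₂ c (a loop when they coincide).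

record Network : Set where
  field
    nParties : ℕ
    nChans   : ℕ
    end₁     : Fin nChans → Fin nParties
    end₂     : Fin nChans → Fin nParties

module _ (N : Network) where
  open Network N

  Party : Set
  Party = Fin nParties

  Ch : Set
  Ch = Fin nChans

  Chans : Set
  Chans = Subset nChans

  Incident : Party → Ch → Set
  Incident p c = (end₁ c ≡ p) ⊎ (end₂ c ≡ p)

  Joins : Ch → Party → Party → Set
  Joins c u v = (end₁ c ≡ u × end₂ c ≡ v) ⊎ (end₁ c ≡ v × end₂ c ≡ u)

  -- A walk whose first channel is c, whose last channel is d and which
  -- currently ends at party v.
  data Walk : Ch → Ch → Party → Set where
    one  : ∀ {c u v} → Joins c u v → Walk c c v
    step : ∀ {c d e u v} → Walk c d u → Joins e u v → Walk c e v

  channels : ∀ {c d v} → Walk c d v → List Ch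
  channels (one {c} _)      = c ∷ []
  channels (step {e = e} w _) = channels w ++ (e ∷ [])

  Gateway : Chans → Chans → Chans → Set
  Gateway A B G = ∀ {c d v} (w : Walk c d v) → c ∈ A → d ∈ B →
                  Any (λ e → e ∈ G) (channels w)

  infixr 5 _⇒_
  infix 6 _▷_
  data Φ : Set where
    _▷_ : Chans → Chans → Φ
    ⊥'  : Φ
    _⇒_ : Φ → Φ → Φ

  evalB : (Chans → Chans → Bool) → Φ → Bool
  evalB v (A ▷ B) = v A B
  evalB v ⊥'      = false
  evalB v (φ ⇒ ψ) = not (evalB v φ) ∨ evalB v ψ

  Tautology : Φ → Set
  Tautology φ = ∀ (v : Chans → Chans → Bool) → evalB v φ ≡ true

  data ⊢_ : Φ → Set where
    taut  : ∀ {φ} → Tautology φ → ⊢ φ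
    mp    : ∀ {φ ψ} → ⊢ (φ ⇒ ψ) → ⊢ φ → ⊢ ψ
    refl▷ : ∀ {A B} → B ⊆ A → ⊢ (A ▷ B)
    aug   : ∀ {A B C} → ⊢ ((A ▷ B) ⇒ ((A ∪ C) ▷ (B ∪ C)))
    trans : ∀ {A B C} → ⊢ ((A ▷ B) ⇒ ((B ▷ C) ⇒ (A ▷ C)))
    gate  : ∀ {A B G} → Gateway A B G → ⊢ ((A ▷ B) ⇒ (G ▷ B))

  record SemiProtocol : Set₁ where
    field
      V : Ch → Set
      L : (p : Party) → ((c : Ch) → Incident p c → V c) → Set

  module _ (P : SemiProtocol) where
    open SemiProtocol P

    IsRun : ((c : Ch) → V c) → Set
    IsRun r = ∀ (p : Party) → L p (λ c _ → r c)

    Run : Set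
    Run = Σ ((c : Ch) → V c) IsRun

    FiniteSP : Set
    FiniteSP = ∀ (c : Ch) → Σ ℕ (λ k → V c ↔ Fin k)

    FunDet : Chans → Chans → Set
    FunDet A B = ∀ (r r' : Run) →
      (∀ c → c ∈ A → proj₁ r c ≡ proj₁ r' c) →
      (∀ c → c ∈ B → proj₁ r c ≡ proj₁ r' c)

    _⊨_ : Φ → Set
    _⊨_ (A ▷ B) = FunDet A B
    _⊨_ ⊥'      = ⊥
    _⊨_ (φ ⇒ ψ) = _⊨_ φ → _⊨_ ψ

  Protocol : Set₁
  Protocol = Σ SemiProtocol Run

  FiniteProtocol : Protocol → Set
  FiniteProtocol (P , _) = FiniteSP P

  Sat : Protocol → Φ → Set
  Sat (P , _) φ = _⊨_ P φ

-- 1. Propositional reduction.  Whether G is a gateway between A and B is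
--    decidable (reachability by walks avoiding G, computed by iterating a
--    growth step on the finite powerset of channels), so the finitely many instances
--    Γ of the four axiom schemes can be listed.  If φ is not derivable then
--    neither is Γ ⇛ φ (modus ponens), so it is not a tautology; tautologies
--    being decidable, some valuation v of the atoms A ▷ B satisfies all of Γ
--    and falsifies φ.  Such an "axiomatic" v obeys the derived rules of
--    functional dependence (weakening, union, determination by singletons).
-- 2. Canonical protocol.  Channels carry truth tables with one bit per set I
--    of channels; bit I vanishes on channels x with v(I ▷ {x}) and is shared
--    at each party by the remaining incident channels.  Tables are a finite type.
-- 3. Truth lemma.  The canonical protocol satisfies A ▷ B exactly when
--    v(A ▷ B) = true, and therefore it falsifies φ.

module Submission where

open import Defs
open import Data.Bool as Bool using (Bool; true; false; not; _∨_; if_then_else_)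
open import Data.Empty using (⊥-elim)
open import Data.Fin as Fin using (Fin)
import Data.Fin.Properties as FinP
open import Data.Fin.Subset using (Subset; inside; outside; _∈_; _∉_; _⊆_; _∪_; ⁅_⁆; ⋃; ∣_∣)
open import Data.Fin.Subset.Properties
  using (_∈?_; _⊆?_; ⊆-reflexive; ∪-comm; ∪-idem; x∈p∪q⁺; x∈⁅x⁆; x∈⁅y⁆⇒x≡y; ∉⊥; ∣p∣≤n; p⊂q⇒∣p∣<∣q∣)
open import Data.List using (List; []; _∷_; _++_; foldr; map; concatMap; cartesianProduct; cartesianProductWith; allFin)
open import Data.List.Membership.Propositional using (lose) renaming (_∈_ to _∈ₗ_; _∉_ to _∉ₗ_)
open import Data.List.Membership.Propositional.Properties
  using (∈-cartesianProductWith⁺; ∈-cartesianProduct⁺; ∈-concatMap⁺; ∈-concatMap⁻; ∈-filter⁺; ∈-allFin; ∈-++⁻; ∈-++⁺ˡ; ∈-++⁺ʳ)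
open import Data.List.Relation.Unary.All as All using (All; []; _∷_)
open import Data.List.Relation.Unary.All.Properties using (¬Any⇒All¬; All¬⇒¬Any; all-filter; ++⁺; ++⁻)
open import Data.List.Relation.Unary.Any as Any using (Any; here; there)
open import Data.Nat using (ℕ; zero; suc; _+_; _*_; _≤_; _<_)
open import Data.Nat.Properties using (m≤n+m; +-suc; +-identityʳ; +-monoˡ-≤; ≤-trans; ≤-reflexive; <⇒≱)
open import Data.Product using (Σ; _×_; _,_; proj₁; proj₂)
open import Data.Product.Function.NonDependent.Propositional using (_×-↔_)
import Data.Product.Properties as ProductP
open import Data.Sum using (_⊎_; inj₁; inj₂)
open import Data.Vec using ([]; _∷_; tabulate)
import Data.Vec.Properties as VecP
open import Function using (id; _∘_)
open import Function.Bundles using (_↔_)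
open import Function.Construct.Composition using (_↔-∘_)
open import Function.Construct.Symmetry using (↔-sym)
open import Relation.Binary.PropositionalEquality as ≡ using (_≡_; _≢_; refl; sym; cong; cong₂; subst)
open import Relation.Nullary using (¬_; Dec; yes; no; does)
open import Relation.Nullary.Decidable using (_×-dec_; _⊎-dec_; ¬?; decidable-stable; dec-true)
open import Relation.Nullary.Reflects using (Reflects; ofʸ; ofⁿ; _→-reflects_; invert)
open import Relation.Unary using (Decidable)

-- Truth tables: a representation of functions Subset k → Bool as a
-- finite type whose propositional equality is extensional.

Table : ℕ → Set
Table zero    = Bool
Table (suc k) = Table k × Table k

infixl 9 _!_
_!_ : ∀ {k} → Table k → Subset k → Bool
_!_ {zero}  t         []            = t
_!_ {suc k} (tᵢ , tₒ) (inside  ∷ I) = tᵢ ! I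
_!_ {suc k} (tᵢ , tₒ) (outside ∷ I) = tₒ ! I

tabulateT : ∀ {k} → (Subset k → Bool) → Table k
tabulateT {zero}  f = f []
tabulateT {suc k} f = tabulateT (f ∘ (inside ∷_)) , tabulateT (f ∘ (outside ∷_))

!-tabulateT : ∀ {k} (f : Subset k → Bool) I → tabulateT f ! I ≡ f I
!-tabulateT {zero}  f []            = refl
!-tabulateT {suc k} f (inside  ∷ I) = !-tabulateT (f ∘ (inside ∷_)) I
!-tabulateT {suc k} f (outside ∷ I) = !-tabulateT (f ∘ (outside ∷_)) I

table-ext : ∀ {k} (t t′ : Table k) → (∀ I → t ! I ≡ t′ ! I) → t ≡ t′
table-ext {zero}  t t′ same = same []
table-ext {suc k} (tᵢ , tₒ) (tᵢ′ , tₒ′) same =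
  cong₂ _,_ (table-ext tᵢ tᵢ′ (same ∘ (inside ∷_))) (table-ext tₒ tₒ′ (same ∘ (outside ∷_)))

tableSize : ℕ → ℕ
tableSize zero    = 2
tableSize (suc k) = tableSize k * tableSize k

table↔Fin : ∀ k → Table k ↔ Fin (tableSize k)
table↔Fin zero    = ↔-sym FinP.2↔Bool
table↔Fin (suc k) = ↔-sym ((↔-sym (table↔Fin k) ×-↔ ↔-sym (table↔Fin k)) ↔-∘ FinP.*↔×)

∈-tabulate⁺ : ∀ {n} (f : Fin n → Bool) {x} → f x ≡ true → x ∈ tabulate f
∈-tabulate⁺ f {x} fx = VecP.lookup⇒[]= x (tabulate f) (≡.trans (VecP.lookup∘tabulate f x) fx)

∈-tabulate⁻ : ∀ {n} (f : Fin n → Bool) {x} → x ∈ tabulate f → f x ≡ true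
∈-tabulate⁻ f {x} x∈ = ≡.trans (sym (VecP.lookup∘tabulate f x)) (VecP.[]=⇒lookup x∈)

select : ∀ {n} {P : Fin n → Set} → Decidable P → Subset n
select P? = tabulate (λ x → does (P? x))

∈-select⁺ : ∀ {n} {P : Fin n → Set} (P? : Decidable P) {x} → P x → x ∈ select P?
∈-select⁺ P? {x} px = ∈-tabulate⁺ _ (dec-true (P? x) px)

∈-select⁻ : ∀ {n} {P : Fin n → Set} (P? : Decidable P) {x} → x ∈ select P? → P x
∈-select⁻ P? {x} x∈ with P? x | ∈-tabulate⁻ (λ y → does (P? y)) x∈
... | yes px | _ = px
... | no _   | ()

_≟ₛ_ : ∀ {n} (p q : Subset n) → Dec (p ≡ q)
_≟ₛ_ = VecP.≡-dec Bool._≟_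

⁅⁆⊆ : ∀ {n} {x : Fin n} {A} → x ∈ A → ⁅ x ⁆ ⊆ A
⁅⁆⊆ {A = A} x∈A y∈⁅x⁆ = subst (_∈ A) (sym (x∈⁅y⁆⇒x≡y _ y∈⁅x⁆)) x∈A

∈-union-singletons : ∀ {n} {x : Fin n} {xs} → x ∈ₗ xs → x ∈ ⋃ (map ⁅_⁆ xs)
∈-union-singletons {x = x} (here refl) = x∈p∪q⁺ (inj₁ (x∈⁅x⁆ x))
∈-union-singletons (there x∈xs)        = x∈p∪q⁺ (inj₂ (∈-union-singletons x∈xs))

subsets : ∀ k → List (Subset k)
subsets zero    = [] ∷ []
subsets (suc k) = cartesianProductWith _∷_ (inside ∷ outside ∷ []) (subsets k)

∈-subsets : ∀ {k} (I : Subset k) → I ∈ₗ subsets k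
∈-subsets []            = here refl
∈-subsets (inside  ∷ I) = ∈-cartesianProductWith⁺ _∷_ {xs = inside ∷ outside ∷ []} (here refl) (∈-subsets I)
∈-subsets (outside ∷ I) = ∈-cartesianProductWith⁺ _∷_ {xs = inside ∷ outside ∷ []} (there (here refl)) (∈-subsets I)

-- Closure on a finite powerset: iterating an inflationary operator F from R
-- reaches a set closed under F after at most n steps, and every property
-- preserved by F survives the iteration.

module Closure {n : ℕ} (F : Subset n → Subset n) (inflationary : ∀ R → R ⊆ F R)
               (Inv : Subset n → Set) (preserved : ∀ {R} → Inv R → Inv (F R)) where

  record Fixpoint (R₀ : Subset n) : Set where
    field
      set       : Subset n
      includes  : R₀ ⊆ set
      invariant : Inv set
      closed    : F set ⊆ set

  private
    -- each step that does not stop adds an element, so n steps suffice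
    iterate : ∀ fuel R → n ≤ ∣ R ∣ + fuel → Inv R → Fixpoint R
    iterate fuel R bound inv with FinP.any? (λ x → x ∈? F R ×-dec ¬? (x ∈? R))
    ... | no none = record
      { set = R ; includes = id ; invariant = inv
      ; closed = λ {x} x∈FR → decidable-stable (x ∈? R) (λ x∉R → none (x , x∈FR , x∉R)) }
    ... | yes (x , x∈FR , x∉R) = continue fuel bound
      where
      grows : ∣ R ∣ < ∣ F R ∣
      grows = p⊂q⇒∣p∣<∣q∣ (inflationary R , x , x∈FR , x∉R)
      continue : ∀ fuel → n ≤ ∣ R ∣ + fuel → Fixpoint R
      continue zero    bound = ⊥-elim (<⇒≱ grows (≤-trans (∣p∣≤n (F R)) (subst (n ≤_) (+-identityʳ _) bound)))
      continue (suc f) bound = record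
        { set = set ; includes = includes ∘ inflationary R ; invariant = invariant ; closed = closed }
        where
        open Fixpoint (iterate f (F R) (≤-trans bound (≤-trans (≤-reflexive (+-suc _ f)) (+-monoˡ-≤ f grows)))
                                       (preserved inv))

  closure : ∀ R → Inv R → Fixpoint R
  closure R = iterate n R (m≤n+m n ∣ R ∣)

module Walks (N : Network) where
  open Network N

  joins-start : ∀ {c u v} → Joins N c u v → Incident N u c
  joins-start (inj₁ (e₁ , _)) = inj₁ e₁
  joins-start (inj₂ (_ , e₂)) = inj₂ e₂

  joins-end : ∀ {c u v} → Joins N c u v → Incident N v c
  joins-end (inj₁ (_ , e₂)) = inj₂ e₂
  joins-end (inj₂ (e₁ , _)) = inj₁ e₁

  walk-end : ∀ {c d v} → Walk N c d v → Incident N v d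
  walk-end (one j)    = joins-end j
  walk-end (step _ j) = joins-end j

  leave : ∀ {p c} → Incident N p c → Σ (Party N) (Joins N c p)
  leave {c = c} (inj₁ e) = end₂ c , inj₁ (e , refl)
  leave {c = c} (inj₂ e) = end₁ c , inj₂ (refl , e)

  cross : ∀ {u p d} → Incident N u d → Incident N p d → u ≢ p → Joins N d u p
  cross (inj₁ eu) (inj₁ ep) u≢p = ⊥-elim (u≢p (≡.trans (sym eu) ep))
  cross (inj₁ eu) (inj₂ ep) _   = inj₁ (eu , ep)
  cross (inj₂ eu) (inj₁ ep) _   = inj₂ (ep , eu)
  cross (inj₂ eu) (inj₂ ep) u≢p = ⊥-elim (u≢p (≡.trans (sym eu) ep))

  incident? : ∀ p c → Dec (Incident N p c)
  incident? p c = (end₁ c Fin.≟ p) ⊎-dec (end₂ c Fin.≟ p)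

  Adjacent : Ch N → Ch N → Set
  Adjacent e d = Σ (Party N) λ p → Incident N p e × Incident N p d

  adjacent? : ∀ e d → Dec (Adjacent e d)
  adjacent? e d = FinP.any? (λ p → incident? p e ×-dec incident? p d)

  last-channel : ∀ {P : Ch N → Set} {c d v} (w : Walk N c d v) → All P (channels N w) → P d
  last-channel (one _)    (pd ∷ []) = pd
  last-channel (step w _) all with ++⁻ (channels N w) all
  ... | _ , (pd ∷ []) = pd

  AvoidingWalk : Chans N → Ch N → Ch N → Set
  AvoidingWalk G a e = Σ (Party N) λ u → Σ (Walk N a e u) λ w → All (_∉ G) (channels N w)

  -- An avoiding walk can be continued to any adjacent channel outside G:
  -- if the walk does not stop at the shared party, traverse its last channel
  -- once more to get there.
  extend : ∀ {G a d e} → e ∉ G → Adjacent e d → AvoidingWalk G a d → AvoidingWalk G a e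
  extend {G} e∉G (p , p∼e , p∼d) (u , w , avoids) with u Fin.≟ p | leave p∼e
  ... | yes refl | q , p→q = q , step w p→q , ++⁺ avoids (e∉G ∷ [])
  ... | no u≢p   | q , p→q =
    q , step (step w (cross (walk-end w) p∼d u≢p)) p→q ,
    ++⁺ (++⁺ avoids (last-channel w avoids ∷ [])) (e∉G ∷ [])

  -- Whether G is a gateway between A and B is decidable: compute the set R
  -- of channels reachable from A by walks avoiding G, and test whether it
  -- meets B.
  module GatewayDecision (A B G : Chans N) where
    Reachable : Subset nChans → Set
    Reachable R = ∀ {e} → e ∈ R → Σ (Ch N) λ a → a ∈ A × AvoidingWalk G a e

    Grows : Subset nChans → Ch N → Set
    Grows R e = e ∉ G × Σ (Ch N) λ d → d ∈ R × Adjacent e d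

    grows? : ∀ R → Decidable (λ e → e ∈ R ⊎ Grows R e)
    grows? R e = (e ∈? R) ⊎-dec (¬? (e ∈? G) ×-dec FinP.any? (λ d → (d ∈? R) ×-dec adjacent? e d))

    grow : Subset nChans → Subset nChans
    grow R = select (grows? R)

    grow-reachable : ∀ {R} → Reachable R → Reachable (grow R)
    grow-reachable {R} reach e∈ with ∈-select⁻ (grows? R) e∈
    ... | inj₁ e∈R                   = reach e∈R
    ... | inj₂ (e∉G , d , d∈R , e∼d) = let (a , a∈A , w) = reach d∈R in a , a∈A , extend e∉G e∼d w

    start? : Decidable (λ a → a ∈ A × a ∉ G)
    start? a = (a ∈? A) ×-dec ¬? (a ∈? G)

    start-reachable : Reachable (select start?)
    start-reachable {a} a∈ = let (a∈A , a∉G) = ∈-select⁻ start? a∈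
                             in a , a∈A , end₂ a , one (inj₁ (refl , refl)) , a∉G ∷ []

    open Closure grow (λ R → ∈-select⁺ (grows? R) ∘ inj₁) Reachable grow-reachable

    open Fixpoint (closure (select start?) start-reachable)
      renaming (set to R; includes to start⊆R; invariant to R-reachable; closed to R-closed)

    avoiding-in-R : ∀ {c d v} (w : Walk N c d v) → c ∈ A → All (_∉ G) (channels N w) → d ∈ R
    avoiding-in-R (one _) c∈A (c∉G ∷ []) = start⊆R (∈-select⁺ start? (c∈A , c∉G))
    avoiding-in-R (step w j) c∈A avoids with ++⁻ (channels N w) avoids
    ... | avoids-w , (e∉G ∷ []) =
      R-closed (∈-select⁺ (grows? R) (inj₂ (e∉G , _ , avoiding-in-R w c∈A avoids-w , _ , joins-start j , walk-end w)))

    decide : Dec (Gateway N A B G)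
    decide with FinP.any? (λ b → (b ∈? B) ×-dec (b ∈? R))
    ... | yes (b , b∈B , b∈R) =
      let (a , a∈A , _ , w , avoids) = R-reachable b∈R
      in no λ gateway → All¬⇒¬Any avoids (gateway w a∈A b∈B)
    ... | no none = yes λ {c} {d} w c∈A d∈B → decidable-stable (Any.any? (_∈? G) (channels N w))
      λ misses → none (d , d∈B , avoiding-in-R w c∈A (¬Any⇒All¬ _ misses))

  gateway? : ∀ A B G → Dec (Gateway N A B G)
  gateway? A B G = GatewayDecision.decide A B G

module Valuations (N : Network) where
  open Network N

  Valuation : Set
  Valuation = Chans N → Chans N → Bool

  Atom : Set
  Atom = Chans N × Chans N

  _≟-atom_ : (a b : Atom) → Dec (a ≡ b)
  _≟-atom_ = ProductP.≡-dec _≟ₛ_ _≟ₛ_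

  atoms : List Atom
  atoms = cartesianProduct (subsets nChans) (subsets nChans)

  ∈-atoms : ∀ A B → (A , B) ∈ₗ atoms
  ∈-atoms A B = ∈-cartesianProduct⁺ (∈-subsets A) (∈-subsets B)

  evalB-cong : ∀ (v w : Valuation) ψ → (∀ A B → v A B ≡ w A B) → evalB N v ψ ≡ evalB N w ψ
  evalB-cong v w (A ▷ B) same = same A B
  evalB-cong v w ⊥'      same = refl
  evalB-cong v w (φ ⇒ ψ) same = cong₂ (λ a b → not a ∨ b) (evalB-cong v w φ same) (evalB-cong v w ψ same)

  update : Valuation → Atom → Bool → Valuation
  update v (A , B) b A′ B′ = if does ((A′ , B′) ≟-atom (A , B)) then b else v A′ B′

  AgreeOff : List Atom → Valuation → Valuation → Set
  AgreeOff L v w = ∀ A B → (A , B) ∉ₗ L → v A B ≡ w A B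

  update-agrees : ∀ {A B L} v w → AgreeOff ((A , B) ∷ L) v w → AgreeOff L (update v (A , B) (w A B)) w
  update-agrees {A} {B} v w agree A′ B′ ∉L with (A′ , B′) ≟-atom (A , B)
  ... | yes refl = refl
  ... | no ≢     = agree A′ B′ λ { (here eq) → ≢ eq ; (there m) → ∉L m }

  search : ∀ ψ L v → (∀ w → AgreeOff L v w → evalB N w ψ ≡ true) ⊎ Σ Valuation (λ w → evalB N w ψ ≡ false)
  search ψ [] v with evalB N v ψ in holds
  ... | true  = inj₁ λ w agree → ≡.trans (sym (evalB-cong v w ψ λ A B → agree A B λ ())) holds
  ... | false = inj₂ (v , holds)
  search ψ ((A , B) ∷ L) v with search ψ L (update v (A , B) true) | search ψ L (update v (A , B) false)
  ... | inj₂ falsified | _              = inj₂ falsified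
  ... | inj₁ _         | inj₂ falsified = inj₂ falsified
  ... | inj₁ ifTrue    | inj₁ ifFalse   = inj₁ λ w agree → either (w A B) w (update-agrees v w agree)
    where
    either : ∀ b w → AgreeOff L (update v (A , B) b) w → evalB N w ψ ≡ true
    either true  = ifTrue
    either false = ifFalse

  tautology-or-falsifiable : ∀ ψ → Tautology N ψ ⊎ Σ Valuation (λ v → evalB N v ψ ≡ false)
  tautology-or-falsifiable ψ with search ψ atoms (λ _ _ → false)
  ... | inj₁ holds     = inj₁ λ w → holds w λ A B ∉atoms → ⊥-elim (∉atoms (∈-atoms A B))
  ... | inj₂ falsified = inj₂ falsified

module Axioms (N : Network) where
  open Network N
  open Valuations N
  open Walks N using (gateway?)

  record Axiomatic (v : Valuation) : Set where
    field
      reflexivity  : ∀ {A B} → B ⊆ A → v A B ≡ true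
      augmentation : ∀ {A B C} → v A B ≡ true → v (A ∪ C) (B ∪ C) ≡ true
      transitivity : ∀ {A B C} → v A B ≡ true → v B C ≡ true → v A C ≡ true
      gateway      : ∀ {A B G} → Gateway N A B G → v A B ≡ true → v G B ≡ true

  provided : ∀ {P : Set} → Dec P → Φ N → List (Φ N)
  provided (yes _) φ = φ ∷ []
  provided (no _)  _ = []

  provided-⊢ : ∀ {P : Set} {φ ψ} (P? : Dec P) → (P → ⊢_ N φ) → ψ ∈ₗ provided P? φ → ⊢_ N ψ
  provided-⊢ (yes p) ⊢φ (here refl) = ⊢φ p

  ∈-provided : ∀ {P : Set} {φ} (P? : Dec P) → P → φ ∈ₗ provided P? φ
  ∈-provided (yes _) _ = here refl
  ∈-provided (no ¬p) p = ⊥-elim (¬p p)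

  instancesAt : Chans N → Chans N → Chans N → List (Φ N)
  instancesAt A B C =
    provided (B ⊆? A) (A ▷ B) ++
    ((A ▷ B) ⇒ ((A ∪ C) ▷ (B ∪ C))) ∷ ((A ▷ B) ⇒ ((B ▷ C) ⇒ (A ▷ C))) ∷
    provided (gateway? A B C) ((A ▷ B) ⇒ (C ▷ B))

  instancesAt-⊢ : ∀ A B C {φ} → φ ∈ₗ instancesAt A B C → ⊢_ N φ
  instancesAt-⊢ A B C φ∈ with ∈-++⁻ (provided (B ⊆? A) (A ▷ B)) φ∈
  ... | inj₁ φ∈refl                 = provided-⊢ (B ⊆? A) refl▷ φ∈refl
  ... | inj₂ (here refl)            = aug
  ... | inj₂ (there (here refl))    = trans
  ... | inj₂ (there (there φ∈gate)) = provided-⊢ (gateway? A B C) gate φ∈gate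

  Triple : Set
  Triple = Chans N × Chans N × Chans N

  instancesOf : Triple → List (Φ N)
  instancesOf (A , B , C) = instancesAt A B C

  triples : List Triple
  triples = cartesianProduct (subsets nChans) (cartesianProduct (subsets nChans) (subsets nChans))

  axiomInstances : List (Φ N)
  axiomInstances = concatMap instancesOf triples

  axiomInstances-⊢ : ∀ {φ} → φ ∈ₗ axiomInstances → ⊢_ N φ
  axiomInstances-⊢ φ∈ with Any.satisfied (∈-concatMap⁻ instancesOf {xs = triples} φ∈)
  ... | (A , B , C) , φ∈instances = instancesAt-⊢ A B C φ∈instances

  ∈-axiomInstances : ∀ A B C {φ} → φ ∈ₗ instancesAt A B C → φ ∈ₗ axiomInstances
  ∈-axiomInstances A B C φ∈ = ∈-concatMap⁺ instancesOf
    (lose (∈-cartesianProduct⁺ (∈-subsets A) (∈-cartesianProduct⁺ (∈-subsets B) (∈-subsets C))) φ∈)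

  detach : ∀ {a b} → not a ∨ b ≡ true → a ≡ true → b ≡ true
  detach holds refl = holds

  axiomatic : ∀ v → (∀ {φ} → φ ∈ₗ axiomInstances → evalB N v φ ≡ true) → Axiomatic v
  axiomatic v satisfies = record
    { reflexivity  = λ {A} {B} B⊆A → holds A B A (∈-++⁺ˡ (∈-provided (B ⊆? A) B⊆A))
    ; augmentation = λ {A} {B} {C} → detach (holds A B C (∈-++⁺ʳ _ (here refl)))
    ; transitivity = λ {A} {B} {C} → detach ∘ detach (holds A B C (∈-++⁺ʳ _ (there (here refl))))
    ; gateway      = λ {A} {B} {G} gw → detach (holds A B G (∈-++⁺ʳ _ (there (there (∈-provided (gateway? A B G) gw)))))
    }
    where
    holds : ∀ A B C {φ} → φ ∈ₗ instancesAt A B C → evalB N v φ ≡ true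
    holds A B C = satisfies ∘ ∈-axiomInstances A B C

  infixr 4 _⇛_
  _⇛_ : List (Φ N) → Φ N → Φ N
  Γ ⇛ φ = foldr _⇒_ φ Γ

  discharge : ∀ Γ {φ} → (∀ {γ} → γ ∈ₗ Γ → ⊢_ N γ) → ⊢_ N (Γ ⇛ φ) → ⊢_ N φ
  discharge []      _       ⊢φ  = ⊢φ
  discharge (γ ∷ Γ) ⊢Γ ⊢γ⇛φ = discharge Γ (⊢Γ ∘ there) (mp ⊢γ⇛φ (⊢Γ (here refl)))

  falsify-⇛ : ∀ v Γ {φ} → evalB N v (Γ ⇛ φ) ≡ false →
              (∀ {γ} → γ ∈ₗ Γ → evalB N v γ ≡ true) × evalB N v φ ≡ false
  falsify-⇛ v []      fails = (λ ()) , fails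
  falsify-⇛ v (γ ∷ Γ) fails with evalB N v γ in γ-holds
  ... | true = let (Γ-holds , φ-fails) = falsify-⇛ v Γ fails
               in (λ { (here refl) → γ-holds ; (there γ∈) → Γ-holds γ∈ }) , φ-fails

  -- Propositional reduction: an underivable formula is falsified by an
  -- axiomatic valuation, since axiomInstances ⇛ φ is not a tautology.
  countermodel : ∀ φ → ¬ ⊢_ N φ → Σ Valuation λ v → Axiomatic v × evalB N v φ ≡ false
  countermodel φ ⊬φ with tautology-or-falsifiable (axiomInstances ⇛ φ)
  ... | inj₁ tautology = ⊥-elim (⊬φ (discharge axiomInstances axiomInstances-⊢ (taut tautology)))
  ... | inj₂ (v , fails) = let (satisfies , φ-fails) = falsify-⇛ v axiomInstances fails
                           in v , axiomatic v satisfies , φ-fails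

  module Consequences {v : Valuation} (ax : Axiomatic v) where
    open Axiomatic ax

    weaken : ∀ {A B B′} → B′ ⊆ B → v A B ≡ true → v A B′ ≡ true
    weaken B′⊆B vAB = transitivity vAB (reflexivity B′⊆B)

    -- the union rule, derived as in Armstrong's axiomatization
    union : ∀ {A B₁ B₂} → v A B₁ ≡ true → v A B₂ ≡ true → v A (B₁ ∪ B₂) ≡ true
    union {A} {B₁} {B₂} vAB₁ vAB₂ = weaken (⊆-reflexive (∪-comm B₁ B₂)) vA[B₂∪B₁]
      where
      vA[B₁∪A] : v A (B₁ ∪ A) ≡ true
      vA[B₁∪A] = transitivity (reflexivity (⊆-reflexive (∪-idem A))) (augmentation vAB₁)
      vA[A∪B₁] : v A (A ∪ B₁) ≡ true
      vA[A∪B₁] = transitivity vA[B₁∪A] (reflexivity (⊆-reflexive (∪-comm A B₁)))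
      vA[B₂∪B₁] : v A (B₂ ∪ B₁) ≡ true
      vA[B₂∪B₁] = transitivity vA[A∪B₁] (augmentation vAB₂)

    union-singletons : ∀ {A} xs → All (λ x → v A ⁅ x ⁆ ≡ true) xs → v A (⋃ (map ⁅_⁆ xs)) ≡ true
    union-singletons []       []           = reflexivity (⊥-elim ∘ ∉⊥)
    union-singletons (x ∷ xs) (vAx ∷ vAxs) = union vAx (union-singletons xs vAxs)

    from-singletons : ∀ {A B} → (∀ {x} → x ∈ B → v A ⁅ x ⁆ ≡ true) → v A B ≡ true
    from-singletons {A} {B} vAx =
      weaken (λ {x} x∈B → ∈-union-singletons (∈-filter⁺ (_∈? B) (∈-allFin x) x∈B))
             (union-singletons _ (All.map vAx (all-filter (_∈? B) (allFin nChans))))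

-- A channel carries a
-- truth table with one bit for every set of channels I.  Bit I is 0 on every
-- channel x with v(I ▷ {x}), and at each party it is shared by all incident
-- channels x with ¬v(I ▷ {x}).

module Canonical (N : Network) (v : Valuations.Valuation N) (ax : Axioms.Axiomatic N v) where
  open Network N
  open Walks N
  open Axioms.Axiomatic ax
  open Axioms.Consequences N ax

  determinedBy : Chans N → Chans N
  determinedBy I = tabulate (λ x → v I ⁅ x ⁆)

  undetermined : ∀ {I x} → x ∉ determinedBy I → v I ⁅ x ⁆ ≡ false
  undetermined {I} {x} x∉ with v I ⁅ x ⁆ in vIx
  ... | true  = ⊥-elim (x∉ (∈-tabulate⁺ (λ y → v I ⁅ y ⁆) vIx))
  ... | false = refl

  record Local (p : Party N) (f : (c : Ch N) → Incident N p c → Table nChans) : Set where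
    field
      determined-zero     : ∀ I x i → v I ⁅ x ⁆ ≡ true → f x i ! I ≡ false
      undetermined-shared : ∀ I x y i j → v I ⁅ x ⁆ ≡ false → v I ⁅ y ⁆ ≡ false → f x i ! I ≡ f y j ! I
  open Local

  canonical : SemiProtocol N
  canonical = record { V = λ _ → Table nChans ; L = Local }

  run-of : (b : Ch N → Chans N → Bool) →
           (∀ I x → v I ⁅ x ⁆ ≡ true → b x I ≡ false) →
           (∀ I x y → v I ⁅ x ⁆ ≡ false → v I ⁅ y ⁆ ≡ false → b x I ≡ b y I) → Run N canonical
  run-of b vanish shared = (λ x → tabulateT (b x)) , λ p → record
    { determined-zero     = λ I x _ vIx → ≡.trans (!-tabulateT (b x) I) (vanish I x vIx)
    ; undetermined-shared = λ I x y _ _ vIx vIy →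
        ≡.trans (!-tabulateT (b x) I) (≡.trans (shared I x y vIx vIy) (sym (!-tabulateT (b y) I)))
    }

  zeroRun : Run N canonical
  zeroRun = run-of (λ _ _ → false) (λ _ _ _ → refl) (λ _ _ _ _ _ → refl)

  spike : Chans N → Ch N → Chans N → Bool
  spike A x I with I ≟ₛ A
  ... | yes _ = not (v I ⁅ x ⁆)
  ... | no _  = false

  spike-vanishes : ∀ A I x → v I ⁅ x ⁆ ≡ true → spike A x I ≡ false
  spike-vanishes A I x vIx with I ≟ₛ A
  ... | yes _ rewrite vIx = refl
  ... | no _              = refl

  spike-shared : ∀ A I x y → v I ⁅ x ⁆ ≡ false → v I ⁅ y ⁆ ≡ false → spike A x I ≡ spike A y I
  spike-shared A I x y vIx vIy with I ≟ₛ A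
  ... | yes _ rewrite vIx | vIy = refl
  ... | no _                    = refl

  spike-at : ∀ A x → spike A x A ≡ not (v A ⁅ x ⁆)
  spike-at A x with A ≟ₛ A
  ... | yes _  = refl
  ... | no A≢A = ⊥-elim (A≢A refl)

  -- every channel of A is determined by A, so spike A vanishes on A
  spike-on : ∀ {A x} I → x ∈ A → spike A x I ≡ false
  spike-on {A} {x} I x∈A with I ≟ₛ A
  ... | yes refl rewrite reflexivity (⁅⁆⊆ x∈A) = refl
  ... | no _                                   = refl

  spikeRun : Chans N → Run N canonical
  spikeRun A = run-of (spike A) (λ I x → spike-vanishes A I x) (λ I x y → spike-shared A I x y)

  constant : ∀ (r : Run N canonical) I {c d u} (w : Walk N c d u) →
             All (_∉ determinedBy I) (channels N w) → proj₁ r c ! I ≡ proj₁ r d ! I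
  constant r I (one _) _ = refl
  constant r I (step {d = d} w j) avoids with ++⁻ (channels N w) avoids
  ... | avoids-w , (e∉ ∷ []) =
    ≡.trans (constant r I w avoids-w)
      (undetermined-shared (proj₂ r _) I d _ (walk-end w) (joins-start j)
        (undetermined (last-channel w avoids-w)) (undetermined e∉))

  separated : ∀ {A b I} (r r′ : Run N canonical) → (∀ c → c ∈ A → proj₁ r c ≡ proj₁ r′ c) →
              proj₁ r b ! I ≢ proj₁ r′ b ! I → Gateway N A ⁅ b ⁆ (determinedBy I)
  separated {A} {b} {I} r r′ agree differ {c} {d} w c∈A d∈⁅b⁆
    with x∈⁅y⁆⇒x≡y b d∈⁅b⁆
  ... | refl = decidable-stable (Any.any? (_∈? determinedBy I) (channels N w)) λ misses →
    let avoids = ¬Any⇒All¬ _ misses in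
    differ (begin
      proj₁ r d ! I   ≡⟨ sym (constant r I w avoids) ⟩
      proj₁ r c ! I   ≡⟨ cong (_! I) (agree c c∈A) ⟩
      proj₁ r′ c ! I  ≡⟨ constant r′ I w avoids ⟩
      proj₁ r′ d ! I  ∎)
    where open ≡.≡-Reasoning

  -- I determines determinedBy I, so by the gateway axiom it determines every
  -- channel that A determines beyond that gateway.
  beyond-gateway : ∀ {A b I} → Gateway N A ⁅ b ⁆ (determinedBy I) → v A ⁅ b ⁆ ≡ true → v I ⁅ b ⁆ ≡ true
  beyond-gateway gw vAb = transitivity (from-singletons (∈-tabulate⁻ _)) (gateway gw vAb)

  true≢false : true ≢ false
  true≢false ()

  -- if v(A ▷ B) then A functionally determines B: bit I of a channel b ∈ B
  -- is either forced to 0, or else it is fixed by A (by separated and beyond-gateway)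
  funDet⁺ : ∀ {A B} → v A B ≡ true → FunDet N canonical A B
  funDet⁺ {A} {B} vAB r r′ agree b b∈B = table-ext _ _ bit
    where
    bit : ∀ I → proj₁ r b ! I ≡ proj₁ r′ b ! I
    bit I with v I ⁅ b ⁆ in vIb
    ... | true  = ≡.trans (determined-zero (proj₂ r (end₁ b)) I b (inj₁ refl) vIb)
                      (sym (determined-zero (proj₂ r′ (end₁ b)) I b (inj₁ refl) vIb))
    ... | false = decidable-stable (_ Bool.≟ _) λ differ →
      true≢false (≡.trans (sym (beyond-gateway (separated r r′ agree differ) (weaken (⁅⁆⊆ b∈B) vAB))) vIb)

  -- if ¬v(A ▷ B), some b ∈ B has ¬v(A ▷ {b}), and spikeRun A and zeroRun
  -- agree on A but differ at b
  funDet⁻ : ∀ {A B} → v A B ≡ false → ¬ FunDet N canonical A B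
  funDet⁻ {A} {B} vAB determines with FinP.any? (λ b → (b ∈? B) ×-dec (v A ⁅ b ⁆ Bool.≟ false))
  ... | no none = true≢false (≡.trans (sym (from-singletons vA⁅x⁆)) vAB)
    where
    vA⁅x⁆ : ∀ {x} → x ∈ B → v A ⁅ x ⁆ ≡ true
    vA⁅x⁆ {x} x∈B with v A ⁅ x ⁆ in vAx
    ... | true  = refl
    ... | false = ⊥-elim (none (x , x∈B , vAx))
  ... | yes (b , b∈B , vAb) = true≢false (begin
      true                            ≡⟨ cong not (sym vAb) ⟩
      not (v A ⁅ b ⁆)                 ≡⟨ sym (spike-at A b) ⟩
      spike A b A                     ≡⟨ sym (!-tabulateT (spike A b) A) ⟩
      proj₁ (spikeRun A) b ! A        ≡⟨ cong (_! A) (determines (spikeRun A) zeroRun agree b b∈B) ⟩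
      proj₁ zeroRun b ! A             ≡⟨ !-tabulateT _ A ⟩
      false                           ∎)
    where
    open ≡.≡-Reasoning
    agree : ∀ c → c ∈ A → proj₁ (spikeRun A) c ≡ proj₁ zeroRun c
    agree c c∈A = table-ext _ _ λ I →
      ≡.trans (!-tabulateT _ I) (≡.trans (spike-on I c∈A) (sym (!-tabulateT _ I)))

  truth : ∀ ψ → Reflects (_⊨_ N canonical ψ) (evalB N v ψ)
  truth (A ▷ B) with v A B in vAB
  ... | true  = ofʸ (funDet⁺ vAB)
  ... | false = ofⁿ (funDet⁻ vAB)
  truth ⊥'      = ofⁿ λ ()
  truth (φ ⇒ ψ) = truth φ →-reflects truth ψ

theorem9 : (N : Network) (φ : Φ N) → ¬ (⊢_ N φ) →
           Σ (Protocol N) (λ P → FiniteProtocol N P × ¬ Sat N P φ)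
theorem9 N φ ⊬φ =
  let (v , ax , φ-fails) = Axioms.countermodel N φ ⊬φ
      open Canonical N v ax
  in (canonical , zeroRun) , (λ _ → _ , table↔Fin _) , invert (subst (Reflects _) φ-fails (truth φ))
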